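{- Let $\rho\ge4$ and $T>0$. Define $Z=(z_i)$ by $z_1=\rho$, $z_2=\rho^2-\rho$, $z_{i+2}=\rho(z_{i+1}-z_i)$; let $Z_T=(z_1,\dots,z_k)$ with $k$ the largest index such that $2\sum_{i=1}^{k-1}z_i+z_k\le T$; let $l$ be the smallest index with $2\sum_{i=1}^{l-1}z_i+z_l\ge T$, $\gamma=T/(2\sum_{i=1}^{l-1}z_i+z_l)$ and $\tilde Z_T=(\gamma z_1,\dots,\gamma z_l)$. Then whichever of $Z_T$ and $\tilde Z_T$ has the larger objective value is an optimal strategy for Maximum Clearance on the line, i.e., its objective value is at least the objective value of every feasible solution of $L_2^{(k)}$, for every $k\ge2$.
   Context: For $k\ge2$, $L_2^{(k)}$ is the linear program in variables $x_1,\dots,x_k$: maximize $x_{k-1}+x_k$ subject to $(C_0)$: $x_1\le\rho$; $(C_j)$: $\sum_{i=1}^{j+1}x_i\le\rho x_j$ for $j\in[1,k-2]$; $(E_{k-1})$: $\sum_{i=1}^k x_i\le \rho x_{k-1}$; $(B)$: $2\sum_{i=1}^{k-1}x_i+x_k\le T$, together with the standing requirements $x_i>0$ and $x_{i+2}>x_i$. A feasible $(x_1,\dots,x_k)$ represents a cyclic search strategy on the infinite line (step $i$ goes to distance $x_i$ on the side given by the parity of $i$ and returns to the root) which is $(1+2\rho)$-competitive, extendable, and respects time budget $T$; its objective value $x_{k-1}+x_k$ is the cleared length. The objective value of a point of length $k$ is the sum of its last two coordinates. -}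

module Defs where

open import Level using (Level) renaming (suc to lsuc)
open import Data.Nat using (ℕ; zero; suc; _∸_) renaming (_≤_ to _≤ℕ_; _<_ to _<ℕ_)
open import Data.Product using (Σ; _×_; _,_; ∃)
open import Data.Sum using (_⊎_)
open import Relation.Nullary using (¬_)
open import Relation.Binary.PropositionalEquality using (_≡_)
open import Algebra.Structures using (IsCommutativeRing)

-- The real numbers, axiomatised as a complete ordered field
-- (any model of these axioms is isomorphic to ℝ).

record RealField (ℓ : Level) : Set (lsuc ℓ) where
  infixl 6 _+_ _-_
  infixl 7 _*_
  infix  4 _≤_ _<_
  field
    Carrier : Set ℓ
    _+_ _*_ : Carrier → Carrier → Carrier
    -_      : Carrier → Carrier
    0# 1#   : Carrier
    _≤_     : Carrier → Carrier → Set ℓ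
    isCommutativeRing : IsCommutativeRing _≡_ _+_ _*_ -_ 0# 1#
    0≢1     : ¬ (0# ≡ 1#)
    inverse : ∀ x → ¬ (x ≡ 0#) → Σ Carrier (λ y → x * y ≡ 1#)
    ≤-refl    : ∀ x → x ≤ x
    ≤-trans   : ∀ {x y z} → x ≤ y → y ≤ z → x ≤ z
    ≤-antisym : ∀ {x y} → x ≤ y → y ≤ x → x ≡ y
    ≤-total   : ∀ x y → (x ≤ y) ⊎ (y ≤ x)
    +-mono-≤  : ∀ {x y} z → x ≤ y → x + z ≤ y + z
    *-nonneg  : ∀ {x y} → 0# ≤ x → 0# ≤ y → 0# ≤ x * y
    lub : (P : Carrier → Set ℓ) → Σ Carrier P →
          Σ Carrier (λ b → ∀ x → P x → x ≤ b) →
          Σ Carrier (λ s → (∀ x → P x → x ≤ s) ×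
                           (∀ b → (∀ x → P x → x ≤ b) → s ≤ b))

  _<_ : Carrier → Carrier → Set ℓ
  x < y = (x ≤ y) × ¬ (x ≡ y)

  four : Carrier
  four = 1# + 1# + 1# + 1#

  _-_ : Carrier → Carrier → Carrier
  x - y = x + (- y)

  sumTo : (ℕ → Carrier) → ℕ → Carrier
  sumTo x zero    = 0#
  sumTo x (suc n) = sumTo x n + x (suc n)

  budget : (ℕ → Carrier) → ℕ → Carrier
  budget x zero    = 0#
  budget x (suc n) = (sumTo x n + sumTo x n) + x (suc n)

  -- objective value x_{n-1} + x_n of a point of length n (with x_0 = 0,
  -- so a point of length 1 has value x_1 and the empty point has value 0)
  objective : (ℕ → Carrier) → ℕ → Carrier
  objective x n = x (n ∸ 1) + x n

  -- the sequence Z: z_1 = ρ, z_2 = ρ² - ρ, z_{i+2} = ρ (z_{i+1} - z_i);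
  -- z_0 = 0 is a padding convention
  Z : Carrier → ℕ → Carrier
  Z ρ zero                  = 0#
  Z ρ (suc zero)            = ρ
  Z ρ (suc (suc zero))      = ρ * ρ - ρ
  Z ρ (suc (suc (suc n)))   = ρ * (Z ρ (suc (suc n)) - Z ρ (suc n))

  -- feasibility for the linear program L_2^{(k)} (coordinates x 1 … x k;
  -- values of x outside [1,k] are irrelevant)
  record FeasibleL2 (ρ T : Carrier) (k : ℕ) (x : ℕ → Carrier) : Set ℓ where
    field
      k≥2  : 2 ≤ℕ k
      pos  : ∀ i → 1 ≤ℕ i → i ≤ℕ k → 0# < x i
      incr : ∀ i → 1 ≤ℕ i → suc (suc i) ≤ℕ k → x i < x (suc (suc i))
      C0   : x 1 ≤ ρ
      Cj   : ∀ j → 1 ≤ℕ j → j ≤ℕ k ∸ 2 → sumTo x (suc j) ≤ ρ * x j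
      Ek-1 : sumTo x k ≤ ρ * x (k ∸ 1)
      B    : budget x k ≤ T

{-# OPTIONS --safe #-}
module Submission where

-- Z is the point that satisfies every constraint (C_j) of L₂ with equality.  Comparing a
-- feasible x with Z constraint by constraint (an LP-duality argument, by induction on the
-- index) shows that Z has, among points with the same number of steps, the largest
-- objective once x₁ ≤ ρ = z₁ is used, and the largest objective per unit of budget.  For
-- ρ ≥ 4 the sequence Z grows and is log-concave, so the objective of its prefixes increases
-- while their objective/budget ratio decreases.  Hence a feasible point with m ≤ k steps is
-- beaten by Z_T, and one with m > k steps has l ≤ m and is beaten by Z̃_T, the prefix of
-- length l rescaled to use exactly the budget T.

open import Defs
open import Data.Nat using (ℕ) renaming (_<_ to _<ℕ_)
open import Data.Product using (_×_)
open import Relation.Binary.PropositionalEquality using (_≡_)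

open import Algebra.Bundles using (CommutativeRing)
open import Data.Empty using (⊥-elim)
open import Data.Nat as ℕ using (zero; suc; _∸_; z≤n; s≤s; _≤′_; ≤′-refl; ≤′-step)
  renaming (_≤_ to _≤ℕ_)
import Data.Nat.Properties as ℕ
open import Data.Product using (Σ; _,_; proj₁; proj₂)
open import Data.Sum using (_⊎_; inj₁; inj₂)
open import Relation.Binary.Bundles using (Poset)
open import Relation.Binary.Structures using (IsPartialOrder)
open import Relation.Binary.PropositionalEquality
  using (refl; sym; trans; cong; cong₂; subst; subst₂; isEquivalence)
import Relation.Binary.Reasoning.PartialOrder as PartialOrderReasoning
open import Relation.Nullary using (¬_)

module OrderedFieldProperties {ℓ} (R : RealField ℓ) where
  open RealField R hiding (+-mono-≤)

  commutativeRing : CommutativeRing ℓ ℓ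
  commutativeRing = record { isCommutativeRing = isCommutativeRing }

  open CommutativeRing commutativeRing public
    using (+-assoc; +-comm; +-identityˡ; +-identityʳ; -‿inverseˡ; -‿inverseʳ;
           *-comm; *-assoc; *-identityʳ; distribˡ; distribʳ; zeroˡ)
  open import Algebra.Properties.Ring (CommutativeRing.ring commutativeRing) public
    using (+-cancelʳ; -‿distribˡ-*; -‿distribʳ-*; -‿involutive)
  open import Algebra.Properties.CommutativeSemigroup
    (CommutativeRing.*-commutativeSemigroup commutativeRing) public
    using (x∙yz≈y∙xz; xy∙z≈xz∙y)
  open import Algebra.Solver.Ring.NaturalCoefficients.Default
    (CommutativeRing.commutativeSemiring commutativeRing) public

  ≤-isPartialOrder : IsPartialOrder _≡_ _≤_
  ≤-isPartialOrder = record
    { isPreorder = record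
      { isEquivalence = isEquivalence
      ; reflexive     = λ { refl → ≤-refl _ }
      ; trans         = ≤-trans
      }
    ; antisym = ≤-antisym
    }

  ≤-poset : Poset ℓ ℓ ℓ
  ≤-poset = record { isPartialOrder = ≤-isPartialOrder }

  module ≤-Reasoning = PartialOrderReasoning ≤-poset

  ≤-reflexive : ∀ {a b} → a ≡ b → a ≤ b
  ≤-reflexive refl = ≤-refl _

  <-≤-trans : ∀ {a b c} → a < b → b ≤ c → a < c
  <-≤-trans (a≤b , a≢b) b≤c =
    ≤-trans a≤b b≤c , λ { refl → a≢b (≤-antisym a≤b b≤c) }

  ≤⇒≯ : ∀ {a b} → a ≤ b → ¬ b < a
  ≤⇒≯ a≤b (b≤a , b≢a) = b≢a (≤-antisym b≤a a≤b)

  [x+y]-y≡x : ∀ x y → (x + y) - y ≡ x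
  [x+y]-y≡x x y = trans (+-assoc x y (- y)) (trans (cong (x +_) (-‿inverseʳ y)) (+-identityʳ x))

  [x-y]+y≡x : ∀ x y → (x - y) + y ≡ x
  [x-y]+y≡x x y = trans (+-assoc x (- y) y) (trans (cong (x +_) (-‿inverseˡ y)) (+-identityʳ x))

  -- Identities that hold only modulo hypotheses K₁ ≡ K₂ are proved by adding
  -- these to both sides, which turns them into polynomial identities for `solve`.
  +-cancelʳ-≡ : ∀ {a b k₁ k₂} → k₁ ≡ k₂ → a + k₁ ≡ b + k₂ → a ≡ b
  +-cancelʳ-≡ {b = b} k₁≡k₂ eq = +-cancelʳ _ _ _ (trans eq (cong (b +_) (sym k₁≡k₂)))

  +-monoˡ-≤ : ∀ {a b} c → a ≤ b → a + c ≤ b + c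
  +-monoˡ-≤ = RealField.+-mono-≤ R

  +-monoʳ-≤ : ∀ {a b} c → a ≤ b → c + a ≤ c + b
  +-monoʳ-≤ {a} {b} c a≤b = subst₂ _≤_ (+-comm a c) (+-comm b c) (+-monoˡ-≤ c a≤b)

  +-mono-≤ : ∀ {a b c d} → a ≤ b → c ≤ d → a + c ≤ b + d
  +-mono-≤ {b = b} {c} a≤b c≤d = ≤-trans (+-monoˡ-≤ c a≤b) (+-monoʳ-≤ b c≤d)

  +-cancelʳ-≤ : ∀ {a b} c → a + c ≤ b + c → a ≤ b
  +-cancelʳ-≤ {a} {b} c h = subst₂ _≤_ ([x+y]-y≡x a c) ([x+y]-y≡x b c) (+-monoˡ-≤ (- c) h)

  +-nonneg : ∀ {a b} → 0# ≤ a → 0# ≤ b → 0# ≤ a + b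
  +-nonneg 0≤a 0≤b = subst (_≤ _) (+-identityʳ 0#) (+-mono-≤ 0≤a 0≤b)

  +-nonneg-pos : ∀ {a b} → 0# ≤ a → 0# < b → 0# < a + b
  +-nonneg-pos {a} {b} 0≤a 0<b =
    <-≤-trans 0<b (subst (_≤ a + b) (+-identityˡ b) (+-monoˡ-≤ b 0≤a))

  x≤x+y : ∀ {y} x → 0# ≤ y → x ≤ x + y
  x≤x+y x 0≤y = subst (_≤ x + _) (+-identityʳ x) (+-monoʳ-≤ x 0≤y)

  ≤-by-slack : ∀ {a b} w → 0# ≤ w → a + w ≡ b → a ≤ b
  ≤-by-slack {a} w 0≤w refl = x≤x+y a 0≤w

  slack : ∀ {a b} → a ≤ b → Σ Carrier λ w → 0# ≤ w × a + w ≡ b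
  slack {a} {b} a≤b =
    b - a ,
    subst (_≤ b - a) (-‿inverseʳ a) (+-monoˡ-≤ (- a) a≤b) ,
    trans (+-comm a (b - a)) ([x-y]+y≡x b a)

  *-monoˡ-≤ : ∀ {a b c} → 0# ≤ c → a ≤ b → a * c ≤ b * c
  *-monoˡ-≤ {a} {c = c} 0≤c a≤b with slack a≤b
  ... | w , 0≤w , refl = ≤-by-slack (w * c) (*-nonneg 0≤w 0≤c) (sym (distribʳ c a w))

  *-monoʳ-≤ : ∀ {a b c} → 0# ≤ c → a ≤ b → c * a ≤ c * b
  *-monoʳ-≤ {a} {b} {c} 0≤c a≤b = subst₂ _≤_ (*-comm a c) (*-comm b c) (*-monoˡ-≤ 0≤c a≤b)

  *-cancelʳ-≡ : ∀ {a b c} → ¬ c ≡ 0# → a * c ≡ b * c → a ≡ b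
  *-cancelʳ-≡ {a} {b} {c} c≢0 ac≡bc with inverse c c≢0
  ... | c⁻¹ , cc⁻¹≡1 = trans (sym (undo a)) (trans (cong (_* c⁻¹) ac≡bc) (undo b))
    where
    undo : ∀ y → (y * c) * c⁻¹ ≡ y
    undo y = trans (*-assoc y c c⁻¹) (trans (cong (y *_) cc⁻¹≡1) (*-identityʳ y))

  *-cancelʳ-≤ : ∀ {a b c} → 0# < c → a * c ≤ b * c → a ≤ b
  *-cancelʳ-≤ {a} {b} (0≤c , 0≢c) ac≤bc with ≤-total a b
  ... | inj₁ a≤b = a≤b
  ... | inj₂ b≤a = ≤-reflexive (*-cancelʳ-≡ (λ c≡0 → 0≢c (sym c≡0))
                                            (≤-antisym ac≤bc (*-monoˡ-≤ 0≤c b≤a)))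

  *-cancelˡ-≤ : ∀ {a b c} → 0# < c → c * a ≤ c * b → a ≤ b
  *-cancelˡ-≤ {a} {b} {c} 0<c ca≤cb =
    *-cancelʳ-≤ 0<c (subst₂ _≤_ (*-comm c a) (*-comm c b) ca≤cb)

  nonneg-factor : ∀ {a b} → 0# ≤ b → 0# < a * b → 0# ≤ a
  nonneg-factor {a} {b} 0≤b 0<ab with ≤-total 0# a
  ... | inj₁ 0≤a = 0≤a
  ... | inj₂ a≤0 = ⊥-elim (≤⇒≯ (subst (a * b ≤_) (zeroˡ b) (*-monoˡ-≤ 0≤b a≤0)) 0<ab)

  square-nonneg : ∀ x → 0# ≤ x * x
  square-nonneg x with ≤-total 0# x
  ... | inj₁ 0≤x = *-nonneg 0≤x 0≤x
  ... | inj₂ x≤0 = subst (0# ≤_) -x*-x≡x*x (*-nonneg 0≤-x 0≤-x)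
    where
    0≤-x : 0# ≤ - x
    0≤-x = subst₂ _≤_ (-‿inverseʳ x) (+-identityˡ (- x)) (+-monoˡ-≤ (- x) x≤0)
    -x*-x≡x*x : - x * - x ≡ x * x
    -x*-x≡x*x = trans (sym (-‿distribˡ-* x (- x)))
                  (trans (cong -_ (sym (-‿distribʳ-* x x))) (-‿involutive (x * x)))

  0≤1 : 0# ≤ 1#
  0≤1 = subst (0# ≤_) (*-identityʳ 1#) (square-nonneg 1#)

  0<1 : 0# < 1#
  0<1 = 0≤1 , 0≢1

  0<four : 0# < four
  0<four = <-≤-trans 0<1 (≤-trans (x≤x+y 1# 0≤1) (≤-trans (x≤x+y _ 0≤1) (x≤x+y _ 0≤1)))

  mono-≤-by-steps : (f : ℕ → Carrier) → (∀ n → f n ≤ f (suc n)) →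
                    ∀ {m n} → m ≤ℕ n → f m ≤ f n
  mono-≤-by-steps f step m≤n = go (ℕ.≤⇒≤′ m≤n)
    where
    go : ∀ {m n} → m ≤′ n → f m ≤ f n
    go ≤′-refl        = ≤-refl _
    go (≤′-step m≤′n) = ≤-trans (go m≤′n) (step _)

  -- Transitivity of e/f ≤ c/d ≤ a/b, in cross-multiplied form.
  quotient-≤-trans : ∀ {a b c d e f} → 0# ≤ b → 0# < d → 0# ≤ f →
                     c * b ≤ a * d → e * d ≤ c * f → e * b ≤ a * f
  quotient-≤-trans {a} {b} {c} {d} {e} {f} 0≤b 0<d 0≤f cb≤ad ed≤cf = *-cancelʳ-≤ 0<d (begin
    (e * b) * d  ≡⟨ xy∙z≈xz∙y e b d ⟩
    (e * d) * b  ≤⟨ *-monoˡ-≤ 0≤b ed≤cf ⟩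
    (c * f) * b  ≡⟨ xy∙z≈xz∙y c f b ⟩
    (c * b) * f  ≤⟨ *-monoˡ-≤ 0≤f cb≤ad ⟩
    (a * d) * f  ≡⟨ xy∙z≈xz∙y a d f ⟩
    (a * f) * d  ∎)
    where open ≤-Reasoning

module MaximumClearance {ℓ} (R : RealField ℓ) where
  open RealField R hiding (+-mono-≤)
  open OrderedFieldProperties R

  -- The constraints (C_j) for 1 ≤ j ≤ n; (E_{k-1}) of L₂⁽ᵏ⁾ is (C_{k-1}).
  ConstraintsUpTo : Carrier → (ℕ → Carrier) → ℕ → Set ℓ
  ConstraintsUpTo ρ x n = ∀ j → 1 ≤ℕ j → j ≤ℕ n → sumTo x (suc j) ≤ ρ * x j

  constraintsUpTo-pred : ∀ {ρ x n} → ConstraintsUpTo ρ x (suc n) → ConstraintsUpTo ρ x n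
  constraintsUpTo-pred C j 1≤j j≤n = C j 1≤j (ℕ.m≤n⇒m≤1+n j≤n)

  constraintsUpTo-last : ∀ {ρ x n} → ConstraintsUpTo ρ x (suc n) →
                         sumTo x (2 ℕ.+ n) ≤ ρ * x (suc n)
  constraintsUpTo-last C = C _ (s≤s z≤n) ℕ.≤-refl

  module ZSequence (ρ : Carrier) (4≤ρ : four ≤ ρ) where

    z : ℕ → Carrier
    z = Z ρ

    ζ : ℕ → Carrier
    ζ = sumTo z

    0<ρ : 0# < ρ
    0<ρ = <-≤-trans 0<four 4≤ρ

    0≤ρ : 0# ≤ ρ
    0≤ρ = proj₁ 0<ρ

    0≤1+ρ+ρ : 0# ≤ 1# + ρ + ρ
    0≤1+ρ+ρ = +-nonneg (+-nonneg 0≤1 0≤ρ) 0≤ρ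

    z₂+ρ≡ρ*ρ : z 2 + ρ ≡ ρ * ρ
    z₂+ρ≡ρ*ρ = [x-y]+y≡x (ρ * ρ) ρ

    Z-recurrence : ∀ p → z (3 ℕ.+ p) + ρ * z (1 ℕ.+ p) ≡ ρ * z (2 ℕ.+ p)
    Z-recurrence p = trans (sym (distribˡ ρ _ _)) (cong (ρ *_) ([x-y]+y≡x _ _))

    Z-tight : ∀ p → ζ (2 ℕ.+ p) ≡ ρ * z (1 ℕ.+ p)
    Z-tight zero    = trans (cong (_+ z 2) (+-identityˡ ρ)) (trans (+-comm ρ (z 2)) z₂+ρ≡ρ*ρ)
    Z-tight (suc p) =
      trans (cong (_+ z (3 ℕ.+ p)) (Z-tight p)) (trans (+-comm _ _) (Z-recurrence p))

    Z-tight′ : ∀ p → z (2 ℕ.+ p) + ζ (1 ℕ.+ p) ≡ ρ * z (1 ℕ.+ p)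
    Z-tight′ p = trans (+-comm _ _) (Z-tight p)

    private
      ρ-4 : Carrier
      ρ-4 = proj₁ (slack 4≤ρ)

      0≤ρ-4 : 0# ≤ ρ-4
      0≤ρ-4 = proj₁ (proj₂ (slack 4≤ρ))

      four+[ρ-4]≡ρ : four + ρ-4 ≡ ρ
      four+[ρ-4]≡ρ = proj₂ (proj₂ (slack 4≤ρ))

    -- If b = 2a + f then z₃ = ρ(b − a) = 2b + (ρ − 4)a + (ρ − 2)f.
    Z-nonneg-doubling : ∀ n → 0# ≤ z n × z n + z n ≤ z (suc n)
    Z-nonneg-doubling zero          = ≤-refl 0# , subst (_≤ ρ) (sym (+-identityʳ 0#)) 0≤ρ
    Z-nonneg-doubling (suc zero)    =
      0≤ρ ,
      ≤-by-slack (ρ + ρ * ρ-4) (+-nonneg 0≤ρ (*-nonneg 0≤ρ 0≤ρ-4))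
        (+-cancelʳ-≡ (cong₂ _+_ z₂+ρ≡ρ*ρ (cong (ρ *_) (sym four+[ρ-4]≡ρ)))
          (solve 3 (λ r w e → ((r :+ r) :+ (r :+ r :* e)) :+ ((w :+ r) :+ r :* r)
                              := w :+ (r :* r :+ r :* (con 1 :+ con 1 :+ con 1 :+ con 1 :+ e)))
                   refl ρ (z 2) ρ-4))
    Z-nonneg-doubling (suc (suc p)) with Z-nonneg-doubling (suc p)
    ... | 0≤a , a+a≤b with slack a+a≤b
    ... | f , 0≤f , a+a+f≡b =
      ≤-trans (+-nonneg 0≤a 0≤a) a+a≤b ,
      ≤-by-slack (f + f + ρ-4 * a + ρ-4 * f)
        (+-nonneg (+-nonneg (+-nonneg 0≤f 0≤f) (*-nonneg 0≤ρ-4 0≤a)) (*-nonneg 0≤ρ-4 0≤f))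
        (+-cancelʳ-≡ (cong₂ _+_ (cong₂ _+_ (cong₂ _+_ (Z-recurrence p)
                                                      (cong (b *_) (sym four+[ρ-4]≡ρ)))
                                           (cong (a *_) four+[ρ-4]≡ρ))
                                (cong ((1# + 1# + ρ-4) *_) (sym a+a+f≡b)))
          (solve 6 (λ a b z₃ r e f →
             ((b :+ b) :+ (f :+ f :+ e :* a :+ e :* f))
               :+ ((z₃ :+ r :* a) :+ b :* r :+ a :* ((con 1 :+ con 1 :+ con 1 :+ con 1) :+ e)
                   :+ (con 2 :+ e) :* b)
             := z₃ :+ (r :* b :+ b :* ((con 1 :+ con 1 :+ con 1 :+ con 1) :+ e) :+ a :* r
                       :+ (con 2 :+ e) :* ((a :+ a) :+ f)))
             refl a b (z (3 ℕ.+ p)) ρ ρ-4 f))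
      where
      a b : Carrier
      a = z (1 ℕ.+ p)
      b = z (2 ℕ.+ p)

    Z-nonneg : ∀ n → 0# ≤ z n
    Z-nonneg n = proj₁ (Z-nonneg-doubling n)

    Z-step : ∀ n → z n ≤ z (suc n)
    Z-step n = ≤-trans (x≤x+y (z n) (Z-nonneg n)) (proj₂ (Z-nonneg-doubling n))

    Z-mono : ∀ {m n} → m ≤ℕ n → z m ≤ z n
    Z-mono = mono-≤-by-steps z Z-step

    Z-pos : ∀ {n} → 1 ≤ℕ n → 0# < z n
    Z-pos 1≤n = <-≤-trans 0<ρ (Z-mono 1≤n)

    ζ-nonneg : ∀ n → 0# ≤ ζ n
    ζ-nonneg zero    = ≤-refl 0#
    ζ-nonneg (suc n) = +-nonneg (ζ-nonneg n) (Z-nonneg (suc n))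

    Z≤ζ : ∀ n → z n ≤ ζ n
    Z≤ζ zero    = ≤-refl 0#
    Z≤ζ (suc n) = subst (_≤ ζ (suc n)) (+-identityˡ _) (+-monoˡ-≤ (z (suc n)) (ζ-nonneg n))

    budget-Z-nonneg : ∀ n → 0# ≤ budget z n
    budget-Z-nonneg zero    = ≤-refl 0#
    budget-Z-nonneg (suc n) = +-nonneg (+-nonneg (ζ-nonneg n) (ζ-nonneg n)) (Z-nonneg (suc n))

    budget-Z-pos : ∀ {n} → 1 ≤ℕ n → 0# < budget z n
    budget-Z-pos {suc n} 1≤n =
      +-nonneg-pos (+-nonneg (ζ-nonneg n) (ζ-nonneg n)) (Z-pos {suc n} 1≤n)

    objective-Z-nonneg : ∀ n → 0# ≤ objective z n
    objective-Z-nonneg n = +-nonneg (Z-nonneg (n ∸ 1)) (Z-nonneg n)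

    objective-Z-mono : ∀ {m n} → m ≤ℕ n → objective z m ≤ objective z n
    objective-Z-mono = mono-≤-by-steps (objective z) λ n →
      +-mono-≤ (Z-mono (ℕ.m∸n≤m n 1)) (Z-step n)

    -- The deficit z₂² − z₁z₃ = ρ² is multiplied by ρ at each step.
    Z-logConcave : ∀ p → z (1 ℕ.+ p) * z (3 ℕ.+ p) ≤ z (2 ℕ.+ p) * z (2 ℕ.+ p)
    Z-logConcave zero = ≤-by-slack (ρ * ρ) (square-nonneg ρ)
      (sym (+-cancelʳ-≡ (cong₂ _+_ (cong₂ _+_ (cong (ρ *_) (Z-recurrence 0))
                                              (cong (z 2 *_) (sym z₂+ρ≡ρ*ρ)))
                                   (cong (ρ *_) z₂+ρ≡ρ*ρ))
        (solve 3 (λ r w z₃ → w :* w :+ (r :* (z₃ :+ r :* r) :+ w :* (r :* r) :+ r :* (w :+ r))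
                   := (r :* z₃ :+ r :* r) :+ (r :* (r :* w) :+ w :* (w :+ r) :+ r :* (r :* r)))
                 refl ρ (z 2) (z 3))))
    Z-logConcave (suc p) with slack (Z-logConcave p)
    ... | δ , 0≤δ , ac+δ≡bb = ≤-by-slack (ρ * δ) (*-nonneg 0≤ρ 0≤δ)
      (sym (+-cancelʳ-≡ (cong₂ _+_ (cong₂ _+_ (cong (b *_) (Z-recurrence (suc p)))
                                              (cong (ρ *_) ac+δ≡bb))
                                   (cong (c *_) (sym (Z-recurrence p))))
        (solve 6 (λ r a b c d δ → c :* c :+ (b :* (d :+ r :* b) :+ r :* (a :* c :+ δ) :+ c :* (r :* b))
                   := (b :* d :+ r :* δ) :+ (b :* (r :* c) :+ r :* (b :* b) :+ c :* (c :+ r :* a)))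
                 refl ρ a b c (z (4 ℕ.+ p)) δ)))
      where
      a b c : Carrier
      a = z (1 ℕ.+ p)
      b = z (2 ℕ.+ p)
      c = z (3 ℕ.+ p)

    -- The slack is (1 + 2ρ) times the log-concavity deficit.
    ratio-step : ∀ {n} → 1 ≤ℕ n →
      objective z (suc n) * budget z n ≤ objective z n * budget z (suc n)
    ratio-step {suc zero} _ = ≤-by-slack (ρ * ρ) (square-nonneg ρ)
      (solve 2 (λ r w → (r :+ w) :* ((con 0 :+ con 0) :+ r) :+ r :* r
                        := (con 0 :+ r) :* (((con 0 :+ r) :+ (con 0 :+ r)) :+ w)) refl ρ (z 2))
    ratio-step {suc (suc p)} _ with slack (Z-logConcave p)
    ... | δ , 0≤δ , ac+δ≡bb = ≤-by-slack ((1# + ρ + ρ) * δ) (*-nonneg 0≤1+ρ+ρ 0≤δ)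
      (+-cancelʳ-≡ (cong₂ _+_ (cong₂ _+_ (cong₂ _+_ (cong ((c + c) *_) (sym (Z-tight p)))
                                                    (cong ((a + a) *_) (Z-tight p)))
                                         (cong (((a + b) + (a + b)) *_) (Z-recurrence p)))
                              (cong ((1# + ρ + ρ) *_) (sym ac+δ≡bb)))
        (solve 6 (λ a b c s r δ →
           ((b :+ c) :* ((s :+ s) :+ b) :+ (con 1 :+ r :+ r) :* δ)
             :+ ((c :+ c) :* (r :* a) :+ (a :+ a) :* (s :+ b) :+ ((a :+ b) :+ (a :+ b)) :* (c :+ r :* a)
                 :+ (con 1 :+ r :+ r) :* (b :* b))
           := ((a :+ b) :* (((s :+ b) :+ (s :+ b)) :+ c))
             :+ ((c :+ c) :* (s :+ b) :+ (a :+ a) :* (r :* a) :+ ((a :+ b) :+ (a :+ b)) :* (r :* b)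
                 :+ (con 1 :+ r :+ r) :* (a :* c :+ δ)))
           refl a b c (ζ (1 ℕ.+ p)) ρ δ))
      where
      a b c : Carrier
      a = z (1 ℕ.+ p)
      b = z (2 ℕ.+ p)
      c = z (3 ℕ.+ p)

    ratio-antitone : ∀ {l m} → 1 ≤ℕ l → l ≤ℕ m →
      objective z m * budget z l ≤ objective z l * budget z m
    ratio-antitone {l} 1≤l l≤m = go (ℕ.≤⇒≤′ l≤m)
      where
      go : ∀ {m} → l ≤′ m → objective z m * budget z l ≤ objective z l * budget z m
      go ≤′-refl                = ≤-refl _
      go {suc m} (≤′-step l≤′m) =
        quotient-≤-trans (budget-Z-nonneg l) (budget-Z-pos 1≤m) (budget-Z-nonneg (suc m))
                         (go l≤′m) (ratio-step 1≤m)
        where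
        1≤m : 1 ≤ℕ m
        1≤m = ℕ.≤-trans 1≤l (ℕ.≤′⇒≤ l≤′m)

    module _ (x : ℕ → Carrier) where

      S : ℕ → Carrier
      S = sumTo x

      -- Writing Φ(y) = c·y(n) − d·Σ_{i≤n} y(i) with n = p + 1, this says ρ·Φ(x) ≤ x(1)·Φ(z)
      -- whenever d ≥ 0 and Φ(z) ≥ 0.  Using (C_n), tight for Z, the pair (c, d) at level
      -- n + 1 is traded for (ρ(c − d), c) at level n; the slack of the goal is then the
      -- slack h of the induction hypothesis plus ρ(c − d) times the slack g of (C_n).
      dominance : ∀ p → ConstraintsUpTo ρ x p → ∀ c d → 0# ≤ d → d * ζ (suc p) ≤ c * z (suc p) →
        ρ * (c * x (suc p)) + x 1 * (d * ζ (suc p)) ≤ ρ * (d * S (suc p)) + x 1 * (c * z (suc p))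
      dominance zero _ c d _ _ = ≤-reflexive
        (solve 4 (λ r c d y → r :* (c :* y) :+ y :* (d :* (con 0 :+ r))
                              := r :* (d :* (con 0 :+ y)) :+ y :* (c :* r)) refl ρ c d (x 1))
      dominance (suc p) C c d 0≤d dζ≤cz with slack d≤c
        where
        d≤c : d ≤ c
        d≤c = *-cancelʳ-≤ (Z-pos {2 ℕ.+ p} (s≤s z≤n))
                          (≤-trans (*-monoʳ-≤ 0≤d (Z≤ζ (2 ℕ.+ p))) dζ≤cz)
      ... | e , 0≤e , refl with slack dζ≤cz
      ... | f , 0≤f , dζ+f≡cz
        with slack (dominance p (constraintsUpTo-pred C) (ρ * e) (d + e) (+-nonneg 0≤d 0≤e) cζ≤ρez)
        where
        cζ≤ρez : (d + e) * ζ (1 ℕ.+ p) ≤ (ρ * e) * z (1 ℕ.+ p)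
        cζ≤ρez = ≤-by-slack f 0≤f
          (+-cancelʳ-≡ (cong₂ _+_ (sym dζ+f≡cz) (cong (e *_) (sym (Z-tight′ p))))
            (solve 7 (λ r d e f s₁ z₁ z₂ →
                ((d :+ e) :* s₁ :+ f) :+ ((d :+ e) :* z₂ :+ e :* (r :* z₁))
                := (r :* e) :* z₁ :+ ((d :* (s₁ :+ z₂) :+ f) :+ e :* (z₂ :+ s₁)))
              refl ρ d e f (ζ (1 ℕ.+ p)) (z (1 ℕ.+ p)) (z (2 ℕ.+ p))))
      ... | h , 0≤h , induction-eq with slack (constraintsUpTo-last C)
      ... | g , 0≤g , constraint-eq =
        ≤-by-slack (h + ρ * (e * g)) (+-nonneg 0≤h (*-nonneg 0≤ρ (*-nonneg 0≤e 0≤g)))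
          (+-cancelʳ-≡ (cong₂ _+_ (cong₂ _+_ (cong ((ρ * e) *_) (sym constraint-eq))
                                             (sym induction-eq))
                                  (cong ((x 1 * e) *_) (Z-tight′ p)))
            (solve 12 (λ r d e x₁ xₙ xₙ₊₁ Sₙ ζₙ zₙ zₙ₊₁ g h →
              ((r :* ((d :+ e) :* xₙ₊₁) :+ x₁ :* (d :* (ζₙ :+ zₙ₊₁))) :+ (h :+ r :* (e :* g)))
                :+ ((r :* e) :* (r :* xₙ) :+ (r :* ((d :+ e) :* Sₙ) :+ x₁ :* ((r :* e) :* zₙ))
                    :+ (x₁ :* e) :* (zₙ₊₁ :+ ζₙ))
              := (r :* (d :* (Sₙ :+ xₙ₊₁)) :+ x₁ :* ((d :+ e) :* zₙ₊₁))
                :+ ((r :* e) :* ((Sₙ :+ xₙ₊₁) :+ g)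
                    :+ ((r :* ((r :* e) :* xₙ) :+ x₁ :* ((d :+ e) :* ζₙ)) :+ h)
                    :+ (x₁ :* e) :* (r :* zₙ)))
              refl ρ d e (x 1) (x (1 ℕ.+ p)) (x (2 ℕ.+ p)) (S (1 ℕ.+ p)) (ζ (1 ℕ.+ p))
              (z (1 ℕ.+ p)) (z (2 ℕ.+ p)) g h))

      share-bound : ∀ p → ConstraintsUpTo ρ x p → ζ (suc p) * x (suc p) ≤ z (suc p) * S (suc p)
      share-bound p C = *-cancelˡ-≤ 0<ρ (+-cancelʳ-≤ (x 1 * (ζ n * z n)) (begin
        ρ * (ζ n * x n) + x 1 * (ζ n * z n)  ≡⟨ cong (λ t → ρ * (ζ n * x n) + x 1 * t)
                                                     (*-comm (ζ n) (z n)) ⟩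
        ρ * (ζ n * x n) + x 1 * (z n * ζ n)  ≤⟨ dominance p C (ζ n) (z n) (Z-nonneg n)
                                                     (≤-reflexive (*-comm (z n) (ζ n))) ⟩
        ρ * (z n * S n) + x 1 * (ζ n * z n)  ∎))
        where
        open ≤-Reasoning
        n : ℕ
        n = suc p

      objective-bound : ∀ p → ConstraintsUpTo ρ x (suc p) → x 1 ≤ ρ →
        objective x (2 ℕ.+ p) ≤ objective z (2 ℕ.+ p)
      objective-bound p C x₁≤ρ = *-cancelˡ-≤ 0<ρ (begin
        ρ * objective x (2 ℕ.+ p)    ≤⟨ scaled ⟩
        x 1 * objective z (2 ℕ.+ p)  ≤⟨ *-monoˡ-≤ (objective-Z-nonneg (2 ℕ.+ p)) x₁≤ρ ⟩
        ρ * objective z (2 ℕ.+ p)    ∎)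
        where
        open ≤-Reasoning
        ζ≤[1+ρ]z : 1# * ζ (1 ℕ.+ p) ≤ (1# + ρ) * z (1 ℕ.+ p)
        ζ≤[1+ρ]z = ≤-by-slack (z (2 ℕ.+ p) + z (1 ℕ.+ p))
          (+-nonneg (Z-nonneg (2 ℕ.+ p)) (Z-nonneg (1 ℕ.+ p)))
          (+-cancelʳ-≡ (sym (Z-tight′ p))
            (solve 4 (λ r s₁ z₁ z₂ → (con 1 :* s₁ :+ (z₂ :+ z₁)) :+ r :* z₁
                                     := (con 1 :+ r) :* z₁ :+ (z₂ :+ s₁))
              refl ρ (ζ (1 ℕ.+ p)) (z (1 ℕ.+ p)) (z (2 ℕ.+ p))))
        scaled : ρ * objective x (2 ℕ.+ p) ≤ x 1 * objective z (2 ℕ.+ p)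
        scaled with slack (dominance p (constraintsUpTo-pred C) (1# + ρ) 1# 0≤1 ζ≤[1+ρ]z)
                  | slack (constraintsUpTo-last C)
        ... | h , 0≤h , dominance-eq | g , 0≤g , constraint-eq =
          ≤-by-slack (h + ρ * g) (+-nonneg 0≤h (*-nonneg 0≤ρ 0≤g))
            (+-cancelʳ-≡ (cong₂ _+_ (cong₂ _+_ (cong (ρ *_) (sym constraint-eq)) (sym dominance-eq))
                                    (cong (x 1 *_) (Z-tight′ p)))
              (solve 10 (λ r x₁ xₙ xₙ₊₁ Sₙ ζₙ zₙ zₙ₊₁ g h →
                (r :* (xₙ :+ xₙ₊₁) :+ (h :+ r :* g))
                  :+ (r :* (r :* xₙ) :+ (r :* (con 1 :* Sₙ) :+ x₁ :* ((con 1 :+ r) :* zₙ))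
                      :+ x₁ :* (zₙ₊₁ :+ ζₙ))
                := x₁ :* (zₙ :+ zₙ₊₁)
                  :+ (r :* ((Sₙ :+ xₙ₊₁) :+ g) :+ (r :* ((con 1 :+ r) :* xₙ) :+ x₁ :* (con 1 :* ζₙ) :+ h)
                      :+ x₁ :* (r :* zₙ)))
                refl ρ (x 1) (x (1 ℕ.+ p)) (x (2 ℕ.+ p)) (S (1 ℕ.+ p)) (ζ (1 ℕ.+ p))
                (z (1 ℕ.+ p)) (z (2 ℕ.+ p)) g h))

      -- The slack is (2ζₙ − zₙ)·g + (1 + 2ρ)·h, where g is the slack of (C_n) and h that of
      -- share-bound.
      budget-bound : ∀ p → ConstraintsUpTo ρ x (suc p) →
        budget z (2 ℕ.+ p) * objective x (2 ℕ.+ p) ≤ objective z (2 ℕ.+ p) * budget x (2 ℕ.+ p)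
      budget-bound p C with slack (constraintsUpTo-last C)
                          | slack (share-bound p (constraintsUpTo-pred C))
      ... | g , 0≤g , constraint-eq | h , 0≤h , share-eq =
        ≤-by-slack ((ζ p + ζ (1 ℕ.+ p)) * g + (1# + ρ + ρ) * h)
          (+-nonneg (*-nonneg (+-nonneg (ζ-nonneg p) (ζ-nonneg (1 ℕ.+ p))) 0≤g)
                    (*-nonneg 0≤1+ρ+ρ 0≤h))
          (+-cancelʳ-≡ (cong₂ _+_ (cong₂ _+_ (cong₂ _+_ (cong (x (1 ℕ.+ p) *_) (sym (Z-tight′ p)))
                                                        (cong ((S (1 ℕ.+ p) + S (1 ℕ.+ p)) *_)
                                                              (Z-tight′ p)))
                                             (cong ((ζ p + ζ (1 ℕ.+ p)) *_) (sym constraint-eq)))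
                                  (cong ((1# + ρ + ρ) *_) (sym share-eq)))
            (solve 9 (λ r q a z′ xₙ xₙ₊₁ Sₙ g h →
              ((((q :+ a) :+ (q :+ a)) :+ z′) :* (xₙ :+ xₙ₊₁)
                :+ ((q :+ (q :+ a)) :* g :+ (con 1 :+ r :+ r) :* h))
                :+ (xₙ :* (r :* a) :+ (Sₙ :+ Sₙ) :* (z′ :+ (q :+ a)) :+ (q :+ (q :+ a)) :* (r :* xₙ)
                    :+ (con 1 :+ r :+ r) :* (a :* Sₙ))
              := (a :+ z′) :* ((Sₙ :+ Sₙ) :+ xₙ₊₁)
                :+ (xₙ :* (z′ :+ (q :+ a)) :+ (Sₙ :+ Sₙ) :* (r :* a)
                    :+ (q :+ (q :+ a)) :* ((Sₙ :+ xₙ₊₁) :+ g)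
                    :+ (con 1 :+ r :+ r) :* ((q :+ a) :* xₙ :+ h)))
              refl ρ (ζ p) (z (1 ℕ.+ p)) (z (2 ℕ.+ p)) (x (1 ℕ.+ p)) (x (2 ℕ.+ p)) (S (1 ℕ.+ p)) g h))

  module _ (ρ T : Carrier) (4≤ρ : four ≤ ρ) (0<T : 0# < T) where
    open ZSequence ρ 4≤ρ

    feasible⇒constraintsUpTo : ∀ {p x} → FeasibleL2 ρ T (2 ℕ.+ p) x → ConstraintsUpTo ρ x (suc p)
    feasible⇒constraintsUpTo F j 1≤j j≤1+p with ℕ.m≤n⇒m<n∨m≡n j≤1+p
    ... | inj₁ (s≤s j≤p) = FeasibleL2.Cj F j 1≤j j≤p
    ... | inj₂ refl      = FeasibleL2.Ek-1 F

    short-strategy-bound : ∀ {p x k} → FeasibleL2 ρ T (2 ℕ.+ p) x → 2 ℕ.+ p ≤ℕ k →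
      objective x (2 ℕ.+ p) ≤ objective z k
    short-strategy-bound {p} {x} F m≤k =
      ≤-trans (objective-bound x p (feasible⇒constraintsUpTo F) (FeasibleL2.C0 F))
              (objective-Z-mono m≤k)

    long-strategy-bound : ∀ {p x l γ} → FeasibleL2 ρ T (2 ℕ.+ p) x → 1 ≤ℕ l → l ≤ℕ 2 ℕ.+ p →
      γ * budget z l ≡ T → objective x (2 ℕ.+ p) ≤ objective (λ i → γ * z i) l
    long-strategy-bound {p} {x} {l} {γ} F 1≤l l≤m γB≡T =
      subst (_ ≤_) (distribˡ γ _ _) (*-cancelʳ-≤ (budget-Z-pos {m} (s≤s z≤n)) (begin
        objective x m * budget z m        ≡⟨ *-comm _ _ ⟩
        budget z m * objective x m        ≤⟨ budget-bound x p (feasible⇒constraintsUpTo F) ⟩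
        objective z m * budget x m        ≤⟨ *-monoʳ-≤ (objective-Z-nonneg m) (FeasibleL2.B F) ⟩
        objective z m * T                 ≡⟨ cong (objective z m *_) (sym γB≡T) ⟩
        objective z m * (γ * budget z l)  ≡⟨ x∙yz≈y∙xz _ _ _ ⟩
        γ * (objective z m * budget z l)  ≤⟨ *-monoʳ-≤ 0≤γ (ratio-antitone 1≤l l≤m) ⟩
        γ * (objective z l * budget z m)  ≡⟨ sym (*-assoc _ _ _) ⟩
        γ * objective z l * budget z m    ∎))
      where
      open ≤-Reasoning
      m : ℕ
      m = 2 ℕ.+ p
      0≤γ : 0# ≤ γ
      0≤γ = nonneg-factor (budget-Z-nonneg l) (subst (0# <_) (sym γB≡T) 0<T)

    T≤budget⇒1≤index : ∀ {l} → T ≤ budget z l → 1 ≤ℕ l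
    T≤budget⇒1≤index {zero}  T≤0 = ⊥-elim (≤⇒≯ T≤0 0<T)
    T≤budget⇒1≤index {suc _} _   = s≤s z≤n

    dominated-by-Z-or-Z̃ :
      (k : ℕ) → (∀ j → k <ℕ j → T < budget z j) →
      (l : ℕ) → T ≤ budget z l → (∀ j → j <ℕ l → budget z j < T) →
      (γ : Carrier) → γ * budget z l ≡ T →
      (m : ℕ) (x : ℕ → Carrier) → FeasibleL2 ρ T m x →
      objective x m ≤ objective z k ⊎ objective x m ≤ objective (λ i → γ * z i) l
    dominated-by-Z-or-Z̃ k k-max l T≤Bₗ l-min γ γB≡T m x F with FeasibleL2.k≥2 F
    ... | s≤s (s≤s _) with ℕ.≤-<-connex m k
    ...   | inj₁ m≤k = inj₁ (short-strategy-bound F m≤k)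
    ...   | inj₂ k<m = inj₂ (long-strategy-bound F (T≤budget⇒1≤index T≤Bₗ) l≤m γB≡T)
      where
      l≤m : l ≤ℕ m
      l≤m with ℕ.≤-<-connex l m
      ... | inj₁ l≤m = l≤m
      ... | inj₂ m<l = ⊥-elim (≤⇒≯ (proj₁ (k-max m k<m)) (l-min m m<l))

mainTheorem3 : ∀ {ℓ} (R : RealField ℓ) → let open RealField R in
    (ρ T : Carrier) → four ≤ ρ → 0# < T →
    -- k : largest index with 2 Σ_{i<k} z_i + z_k ≤ T  (Z_T = (z_1,…,z_k))
    (k : ℕ) → budget (Z ρ) k ≤ T → (∀ j → k <ℕ j → T < budget (Z ρ) j) →
    -- l : smallest index with 2 Σ_{i<l} z_i + z_l ≥ T
    (l : ℕ) → T ≤ budget (Z ρ) l → (∀ j → j <ℕ l → budget (Z ρ) j < T) →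
    -- γ = T / (2 Σ_{i<l} z_i + z_l)  (Z̃_T = (γ z_1,…,γ z_l))
    (γ : Carrier) → γ * budget (Z ρ) l ≡ T →
    -- the one of Z_T, Z̃_T with larger objective beats every feasible point of every L_2^{(m)}
    (m : ℕ) (x : ℕ → Carrier) → FeasibleL2 ρ T m x →
      (objective (λ i → γ * Z ρ i) l ≤ objective (Z ρ) k → objective x m ≤ objective (Z ρ) k)
    × (objective (Z ρ) k ≤ objective (λ i → γ * Z ρ i) l → objective x m ≤ objective (λ i → γ * Z ρ i) l)
mainTheorem3 R ρ T 4≤ρ 0<T k _ k-max l T≤Bₗ l-min γ γB≡T m x F
  with MaximumClearance.dominated-by-Z-or-Z̃ R ρ T 4≤ρ 0<T k k-max l T≤Bₗ l-min γ γB≡T m x F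
... | inj₁ x≤Zₖ = (λ _ → x≤Zₖ) , RealField.≤-trans R x≤Zₖ
... | inj₂ x≤Z̃ = (λ Z̃≤Zₖ → RealField.≤-trans R x≤Z̃ Z̃≤Zₖ) , λ _ → x≤Z̃
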